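{- For every graph $G$ with at least one vertex, $$T_t(G)\ \geq\ \max_{v \in V(G)}\chi\big(G^c[N(v)]\big)+1\ \geq\ \max_{v \in V(G)}\omega\big(G^c[N(v)]\big)+1\ =\ is(G)+1,$$ where $G^c[N(v)]$ denotes the complement of the subgraph of $G$ induced by the (open) neighborhood $N(v)$ of $v$.
   Context: All graphs are finite and simple. A tessellation of a graph $G=(V,E)$ is a partition of $V$ into cliques (called tiles); an edge belongs to the tessellation if both its endpoints lie in the same tile. A $k$-tessellation cover of $G$ is a set of $k$ tessellations whose edges together cover $E$. Equivalently, with $\Sigma=\{1,\dots,k\}$, a $k$-tessellation cover is a map $h$ assigning to each edge a nonempty subset of $\Sigma$ such that for each label $i$ the edges whose subset contains $i$ are exactly the edges of a tessellation. A $k$-total tessellation cover of $G$ is a pair $(f,h)$ where $f:V\to\Sigma$ is a proper vertex coloring and $h$ is a $k$-tessellation cover with labels in $\Sigma$, such that every edge $uv$ satisfies $f(u)\notin h(uv)$ and $f(v)\notin h(uv)$. The total tessellation cover number $T_t(G)$ is the minimum $k$ for which $G$ has a $k$-total tessellation cover. $is(G)$ is the number of edges of a maximum induced star (induced subgraph isomorphic to $K_{1,m}$) of $G$. $\chi$ is the chromatic number and $\omega$ the clique number (with $\chi$ and $\omega$ of the empty graph equal to $0$). -}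

module Defs where

open import Data.Nat using (ℕ; zero; suc; _⊔_; _≤_)
open import Data.Fin using (Fin; zero; suc; _≟_)
open import Data.Bool using (Bool; true; false; not; if_then_else_)
open import Data.Product using (Σ; _×_; _,_; proj₁; ∃)
open import Relation.Nullary using (¬_; yes; no; does)
open import Relation.Binary.PropositionalEquality using (_≡_; _≢_; refl; sym; cong)
open import Data.Empty using (⊥-elim)
open import Function.Definitions using (Injective)

record Graph (V : Set) : Set where
  field
    adj     : V → V → Bool
    adj-sym : ∀ u v → adj u v ≡ adj v u
    irrefl  : ∀ v → adj v v ≡ false
open Graph public

Edge : {V : Set} → Graph V → V → V → Set
Edge G u v = adj G u v ≡ true

-- G^c[N(v)]: the complement of the subgraph of G induced by the open
-- neighbourhood N(v).

N : ∀ {n} → Graph (Fin n) → Fin n → Set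
N {n} G v = Σ (Fin n) (λ u → Edge G v u)

coAdj : ∀ {n} → Graph (Fin n) → Fin n → Fin n → Bool
coAdj G u w = if does (u ≟ w) then false else not (adj G u w)

private
  coAdj-sym : ∀ {n} (G : Graph (Fin n)) u w → coAdj G u w ≡ coAdj G w u
  coAdj-sym G u w with u ≟ w | w ≟ u
  ... | yes _ | yes _ = refl
  ... | yes p | no ¬q = ⊥-elim (¬q (sym p))
  ... | no ¬p | yes q = ⊥-elim (¬p (sym q))
  ... | no _ | no _ = cong not (adj-sym G u w)

  coAdj-irr : ∀ {n} (G : Graph (Fin n)) u → coAdj G u u ≡ false
  coAdj-irr G u with u ≟ u
  ... | yes _ = refl
  ... | no ¬p = ⊥-elim (¬p refl)

coNbhd : ∀ {n} (G : Graph (Fin n)) (v : Fin n) → Graph (N G v)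
coNbhd G v = record
  { adj     = λ x y → coAdj G (proj₁ x) (proj₁ y)
  ; adj-sym = λ x y → coAdj-sym G (proj₁ x) (proj₁ y)
  ; irrefl  = λ x → coAdj-irr G (proj₁ x)
  }

Colorable : {V : Set} → Graph V → ℕ → Set
Colorable {V} H c = Σ (V → Fin c) (λ f → ∀ u w → Edge H u w → f u ≢ f w)

IsChromaticNumber : {V : Set} → Graph V → ℕ → Set
IsChromaticNumber H c = Colorable H c × (∀ c' → Colorable H c' → c ≤ c')

HasClique : {V : Set} → Graph V → ℕ → Set
HasClique {V} H w =
  Σ (Fin w → V) (λ s → Injective _≡_ _≡_ s × (∀ i j → i ≢ j → Edge H (s i) (s j)))

IsCliqueNumber : {V : Set} → Graph V → ℕ → Set
IsCliqueNumber H w = HasClique H w × (∀ w' → HasClique H w' → w' ≤ w)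

-- Induced stars K_{1,m}: a centre x and m distinct leaves, each adjacent
-- to x, pairwise non-adjacent.  is(G) is the maximum such m.

HasInducedStar : {V : Set} → Graph V → ℕ → Set
HasInducedStar {V} G m =
  Σ V (λ x → Σ (Fin m → V) (λ s →
      Injective _≡_ _≡_ s
    × (∀ i → Edge G x (s i))
    × (∀ i j → adj G (s i) (s j) ≡ false)))

IsInducedStarNumber : {V : Set} → Graph V → ℕ → Set
IsInducedStarNumber G m = HasInducedStar G m × (∀ m' → HasInducedStar G m' → m' ≤ m)

-- Tessellations and total tessellation covers.
-- A tessellation is a partition of V into cliques, given by a tile
-- assignment t : V → ℕ (vertices in the same tile are adjacent or equal).

IsTessellation : {V : Set} → Graph V → (V → ℕ) → Set
IsTessellation G t = ∀ u w → t u ≡ t w → u ≢ w → Edge G u w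

LabelIsTessellation : {V : Set} {k : ℕ} → Graph V → (V → V → Fin k → Bool) → Fin k → Set
LabelIsTessellation {V} G h i =
  Σ (V → ℕ) (λ t → IsTessellation G t
     × (∀ u w → Edge G u w → (h u w i ≡ true → t u ≡ t w) × (t u ≡ t w → h u w i ≡ true)))

-- h assigns to each edge uv (symmetrically) a nonempty subset of Σ = Fin k.
IsTessellationCover : {V : Set} → Graph V → (k : ℕ) → (V → V → Fin k → Bool) → Set
IsTessellationCover G k h =
    (∀ u w → Edge G u w → h u w ≡ h w u)
  × (∀ u w → Edge G u w → ∃ λ i → h u w i ≡ true)
  × (∀ i → LabelIsTessellation G h i)

IsTotalTessellationCover : {V : Set} → Graph V → (k : ℕ) → (V → Fin k) → (V → V → Fin k → Bool) → Set
IsTotalTessellationCover G k f h =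
    (∀ u w → Edge G u w → f u ≢ f w)
  × IsTessellationCover G k h
  × (∀ u w → Edge G u w → h u w (f u) ≡ false × h u w (f w) ≡ false)

HasTotalTessellationCover : {V : Set} → Graph V → ℕ → Set
HasTotalTessellationCover {V} G k =
  Σ (V → Fin k) (λ f → Σ (V → V → Fin k → Bool) (λ h → IsTotalTessellationCover G k f h))

IsTotalTessellationCoverNumber : {V : Set} → Graph V → ℕ → Set
IsTotalTessellationCoverNumber G T =
  HasTotalTessellationCover G T × (∀ k → HasTotalTessellationCover G k → T ≤ k)

maxFin : ∀ {n} → (Fin n → ℕ) → ℕ
maxFin {zero}  g = 0
maxFin {suc n} g = g zero ⊔ maxFin (λ i → g (suc i))

-- A total tessellation cover with k+1 labels yields a proper k-colouring of
-- G^c[N(v)] for every vertex v: give each neighbour u of v a label of the edge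
-- vu. That label differs from f(v), so k labels remain; and two neighbours
-- carrying the same label i lie in v's tile of tessellation i, hence are
-- adjacent in G, i.e. non-adjacent in the complement. Besides, cliques are
-- never larger than colourings, and the cliques of G^c[N(v)] are exactly the
-- leaf sets of induced stars centred at v.
module Submission where

open import Defs
open import Data.Nat using (ℕ; suc; zero; _≤_; _+_; z≤n)
open import Data.Nat.Properties
  using (⊔-lub; m≤m⊔n; m≤n⊔m; ≤-trans; ≤-antisym; ≤-reflexive; +-comm; +-monoˡ-≤)
open import Data.Fin using (Fin; zero; suc; _≟_; punchOut)
open import Data.Fin.Properties using (injective⇒≤; punchOut-injective)
open import Data.Product using (_×_; _,_; proj₁; proj₂)
open import Data.Bool using (Bool; true; false)
import Data.Bool as Bool
open import Relation.Nullary using (¬_; yes; no)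
open import Relation.Binary.PropositionalEquality
  using (_≡_; _≢_; refl; sym; trans; cong; subst)
open import Data.Empty using (⊥-elim)
open import Axiom.UniquenessOfIdentityProofs using (module Decidable⇒UIP)

maxFin-upperBound : ∀ {n} (g : Fin n → ℕ) i → g i ≤ maxFin g
maxFin-upperBound g zero    = m≤m⊔n _ _
maxFin-upperBound g (suc i) =
  ≤-trans (maxFin-upperBound (λ j → g (suc j)) i) (m≤n⊔m (g zero) _)

maxFin-least : ∀ {n} (g : Fin n → ℕ) {b} → (∀ i → g i ≤ b) → maxFin g ≤ b
maxFin-least {zero}  g g≤b = z≤n
maxFin-least {suc n} g g≤b =
  ⊔-lub (g≤b zero) (maxFin-least (λ j → g (suc j)) (λ j → g≤b (suc j)))

maxFin-mono : ∀ {n} (g h : Fin n → ℕ) → (∀ i → g i ≤ h i) → maxFin g ≤ maxFin h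
maxFin-mono g h g≤h = maxFin-least g (λ i → ≤-trans (g≤h i) (maxFin-upperBound h i))

coAdj⇒≢ : ∀ {n} (G : Graph (Fin n)) u w → coAdj G u w ≡ true → u ≢ w
coAdj⇒≢ G u w co with u ≟ w
coAdj⇒≢ G u w () | yes _
... | no u≢w = u≢w

coAdj⇒nonadjacent : ∀ {n} (G : Graph (Fin n)) u w → coAdj G u w ≡ true → adj G u w ≡ false
coAdj⇒nonadjacent G u w co with u ≟ w | adj G u w
coAdj⇒nonadjacent G u w () | yes _ | _
coAdj⇒nonadjacent G u w () | no _  | true
... | no _ | false = refl

≢∧nonadjacent⇒coAdj : ∀ {n} (G : Graph (Fin n)) u w →
                      u ≢ w → adj G u w ≡ false → coAdj G u w ≡ true
≢∧nonadjacent⇒coAdj G u w u≢w nonadj with u ≟ w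
... | yes u≡w = ⊥-elim (u≢w u≡w)
... | no _ rewrite nonadj = refl

coAdj⇒¬Edge : ∀ {n} (G : Graph (Fin n)) u w → coAdj G u w ≡ true → ¬ Edge G u w
coAdj⇒¬Edge G u w co uw with () ← trans (sym uw) (coAdj⇒nonadjacent G u w co)

N-≡ : ∀ {n} (G : Graph (Fin n)) v {x y : N G v} → proj₁ x ≡ proj₁ y → x ≡ y
N-≡ G v {u , p} {.u , q} refl = cong (u ,_) (Decidable⇒UIP.≡-irrelevant Bool._≟_ p q)

clique≤colors : ∀ {V : Set} (H : Graph V) {w c} → HasClique H w → Colorable H c → w ≤ c
clique≤colors H (s , _ , clique) (f , proper) = injective⇒≤ fs-injective
  where
  fs-injective : ∀ {i j} → f (s i) ≡ f (s j) → i ≡ j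
  fs-injective {i} {j} fsi≡fsj with i ≟ j
  ... | yes i≡j = i≡j
  ... | no i≢j  = ⊥-elim (proper (s i) (s j) (clique i j i≢j) fsi≡fsj)

coNbhd-clique⇒inducedStar : ∀ {n} (G : Graph (Fin n)) v {m} →
                            HasClique (coNbhd G v) m → HasInducedStar G m
coNbhd-clique⇒inducedStar G v (s , s-injective , clique) =
  v , (λ i → proj₁ (s i)) , (λ eq → s-injective (N-≡ G v eq))
    , (λ i → proj₂ (s i)) , nonadjacent
  where
  nonadjacent : ∀ i j → adj G (proj₁ (s i)) (proj₁ (s j)) ≡ false
  nonadjacent i j with i ≟ j
  ... | yes refl = irrefl G (proj₁ (s i))
  ... | no i≢j   = coAdj⇒nonadjacent G _ _ (clique i j i≢j)

inducedStar⇒coNbhd-clique : ∀ {n} (G : Graph (Fin n)) {m} (star : HasInducedStar G m) →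
                            HasClique (coNbhd G (proj₁ star)) m
inducedStar⇒coNbhd-clique G (_ , s , s-injective , leaf , nonadjacent) =
  (λ i → s i , leaf i) , (λ eq → s-injective (cong proj₁ eq)) , clique
  where
  clique : ∀ i j → i ≢ j → coAdj G (s i) (s j) ≡ true
  clique i j i≢j =
    ≢∧nonadjacent⇒coAdj G (s i) (s j) (λ eq → i≢j (s-injective eq)) (nonadjacent i j)

sameLabel⇒adjacent : ∀ {V : Set} {k} (G : Graph V) (h : V → V → Fin k → Bool) {i} →
                     LabelIsTessellation G h i →
                     ∀ {v u w} → Edge G v u → Edge G v w →
                     h v u i ≡ true → h v w i ≡ true → u ≢ w → Edge G u w
sameLabel⇒adjacent G h (t , tessellation , agrees) {v} {u} {w} vu vw hvu hvw u≢w =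
  tessellation u w (trans (sym tv≡tu) tv≡tw) u≢w
  where
  tv≡tu : t v ≡ t u
  tv≡tu = proj₁ (agrees v u vu) hvu
  tv≡tw : t v ≡ t w
  tv≡tw = proj₁ (agrees v w vw) hvw

coNbhd-colorable : ∀ {n k} (G : Graph (Fin n)) v →
                   HasTotalTessellationCover G (suc k) → Colorable (coNbhd G v) k
coNbhd-colorable G v (f , h , _ , (_ , nonempty , tessellations) , avoids) =
  colour , proper
  where
  label : N G v → Fin _
  label (u , vu) = proj₁ (nonempty v u vu)

  has-label : ∀ x → h v (proj₁ x) (label x) ≡ true
  has-label (u , vu) = proj₂ (nonempty v u vu)

  fv≢label : ∀ x → f v ≢ label x
  fv≢label x@(u , vu) fv≡label
    with () ← trans (sym (proj₁ (avoids v u vu)))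
                    (subst (λ j → h v u j ≡ true) (sym fv≡label) (has-label x))

  colour : N G v → Fin _
  colour x = punchOut (fv≢label x)

  proper : ∀ x y → coAdj G (proj₁ x) (proj₁ y) ≡ true → colour x ≢ colour y
  proper x@(u , vu) y@(w , vw) co colour≡ =
    coAdj⇒¬Edge G u w co
      (sameLabel⇒adjacent G h (tessellations (label x)) vu vw (has-label x)
        (subst (λ j → h v w j ≡ true) (sym same-label) (has-label y)) (coAdj⇒≢ G u w co))
    where
    same-label : label x ≡ label y
    same-label = punchOut-injective (fv≢label x) (fv≢label y) colour≡

χ+1≤totalTessellationCover : ∀ {n} (G : Graph (Fin (suc n))) (χN : Fin (suc n) → ℕ) {T} →
                             (∀ v → IsChromaticNumber (coNbhd G v) (χN v)) →
                             HasTotalTessellationCover G T → maxFin χN + 1 ≤ T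
χ+1≤totalTessellationCover G χN {zero} _ (f , _) with () ← f zero
χ+1≤totalTessellationCover G χN {suc k} isχ cover =
  ≤-trans (+-monoˡ-≤ 1 (maxFin-least χN χ≤k)) (≤-reflexive (+-comm k 1))
  where
  χ≤k : ∀ v → χN v ≤ k
  χ≤k v = proj₂ (isχ v) k (coNbhd-colorable G v cover)

lemma2 : ∀ (n : ℕ) (G : Graph (Fin (suc n)))
             (χN ωN : Fin (suc n) → ℕ) (isG T : ℕ)
           → (∀ v → IsChromaticNumber (coNbhd G v) (χN v))
           → (∀ v → IsCliqueNumber (coNbhd G v) (ωN v))
           → IsInducedStarNumber G isG
           → IsTotalTessellationCoverNumber G T
           → (maxFin χN + 1 ≤ T)
           × (maxFin ωN + 1 ≤ maxFin χN + 1)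
           × (maxFin ωN + 1 ≡ isG + 1)
lemma2 n G χN ωN isG T isχ isω (star , star-max) (cover , _) =
    χ+1≤totalTessellationCover G χN isχ cover
  , +-monoˡ-≤ 1 (maxFin-mono ωN χN ω≤χ)
  , cong (_+ 1) (≤-antisym maxω≤is is≤maxω)
  where
  ω≤χ : ∀ v → ωN v ≤ χN v
  ω≤χ v = clique≤colors (coNbhd G v) (proj₁ (isω v)) (proj₁ (isχ v))

  maxω≤is : maxFin ωN ≤ isG
  maxω≤is = maxFin-least ωN λ v →
    star-max (ωN v) (coNbhd-clique⇒inducedStar G v (proj₁ (isω v)))

  is≤maxω : isG ≤ maxFin ωN
  is≤maxω = ≤-trans (proj₂ (isω centre) isG (inducedStar⇒coNbhd-clique G star))
                    (maxFin-upperBound ωN centre)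
    where centre = proj₁ star
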